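{- Let $\alpha=(\alpha_1,\ldots,\alpha_h)$ be a partition, let $k$ be the minimal index with $1\leq k\leq h+1$ such that $\alpha_k+\cdots+\alpha_h<\alpha_1-\alpha_2$, and let $x=\alpha_k+\cdots+\alpha_h$. Assume: $\alpha\notin\mathrm{Sign}$, $(\alpha_2,\ldots,\alpha_h)\in\mathrm{Sign}$ and $\alpha_1>\alpha_2>\alpha_3+\cdots+\alpha_h$; $k\leq h$; $\alpha_1-\alpha_2$ is not a part of $\alpha$; and $\alpha_{k-1}>x$. Then $\beta=(|\alpha|-\alpha_1,x+1,1^{\alpha_1-x-1})$ is a partition, $h^\beta_{2,1}=\alpha_1$, and $\chi^\beta_\alpha=2(-1)^{\alpha_1-x-1}$.
   Context: Empty sums are $0$. $|\lambda|$ is the sum of the parts of $\lambda$; $(b_1,\ldots,b_t,1^m)$ denotes the partition with parts $b_1,\ldots,b_t$ followed by $m$ parts equal to $1$. $h^\lambda_{i,j}$ is the hook length of node $(i,j)$ (row $i$, column $j$) of the Young diagram of $\lambda$. For partitions $\lambda,\mu$ of the same $n$, $\chi^\lambda_\mu$ is the value of the irreducible character of $S_n$ labeled by $\lambda$ on permutations of cycle type $\mu$. $\mathrm{Sign}$ denotes the set of all partitions $(\gamma_1,\ldots,\gamma_r)$ for which there exists $s$ with $0\leq s\leq r$ such that: (i) $\gamma_i>\gamma_{i+1}+\cdots+\gamma_r$ for $1\leq i\leq s$; and (ii) $(\gamma_{s+1},\ldots,\gamma_r)$ is one of $()$, $(1,1)$, $(3,2,1,1)$, $(5,3,2,1)$,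 $(a,a-1,1)$ with $a\geq 2$, $(a,a-1,2,1)$ with $a\geq 4$, or $(a,a-1,3,1)$ with $a\geq 5$. -}

module Defs where

open import Data.Nat using (ℕ; zero; suc; _+_; _∸_; _≤_; _<_; _>_; _≥_; _≡ᵇ_; _<ᵇ_; _≤ᵇ_)
open import Data.Integer as ℤ using (ℤ; +_; -_)
open import Data.List using (List; []; _∷_; _++_; [_]; length; drop; filter; map; foldr)
open import Data.Nat.ListAction using (sum)
open import Data.Bool.ListAction using (any; all)
open import Data.List.Relation.Unary.All using (All)
open import Data.List.Relation.Unary.Linked using (Linked)
open import Data.Bool using (Bool; true; false; if_then_else_; _∧_; not)
open import Data.Product using (_×_; _,_; Σ; proj₁; proj₂)
open import Relation.Binary.PropositionalEquality using (_≡_)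

IsPartition : List ℕ → Set
IsPartition λ′ = All (λ p → 1 ≤ p) λ′ × Linked _≥_ λ′

size : List ℕ → ℕ
size = sum

-- 1-based part λ_i, with λ_i = 0 for i > length λ (and a junk value 0 for i = 0).
at : List ℕ → ℕ → ℕ
at xs       zero          = 0
at []       (suc i)       = 0
at (x ∷ xs) (suc zero)    = x
at (x ∷ xs) (suc (suc i)) = at xs (suc i)

-- tailSum γ i = γ_i + γ_{i+1} + ⋯ + γ_r  (1-based; empty sum = 0)
tailSum : List ℕ → ℕ → ℕ
tailSum γ i = sum (drop (i ∸ 1) γ)

ones : ℕ → List ℕ
ones zero    = []
ones (suc m) = 1 ∷ ones m

colLen : List ℕ → ℕ → ℕ
colLen λ′ j = length (filter (λ p → j Data.Nat.≤? p) λ′)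

hook : List ℕ → ℕ → ℕ → ℕ
hook λ′ i j = (at λ′ i ∸ j) + (colLen λ′ j ∸ i) + 1

data SignTail : List ℕ → Set where
  st-nil   : SignTail []
  st-11    : SignTail (1 ∷ 1 ∷ [])
  st-3211  : SignTail (3 ∷ 2 ∷ 1 ∷ 1 ∷ [])
  st-5321  : SignTail (5 ∷ 3 ∷ 2 ∷ 1 ∷ [])
  st-a1    : ∀ a → a ≥ 2 → SignTail (a ∷ (a ∸ 1) ∷ 1 ∷ [])
  st-a21   : ∀ a → a ≥ 4 → SignTail (a ∷ (a ∸ 1) ∷ 2 ∷ 1 ∷ [])
  st-a31   : ∀ a → a ≥ 5 → SignTail (a ∷ (a ∸ 1) ∷ 3 ∷ 1 ∷ [])

InSign : List ℕ → Set
InSign γ = IsPartition γ ×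
  Σ ℕ (λ s → s ≤ length γ ×
    ((i : ℕ) → 1 ≤ i → i ≤ s → at γ i > tailSum γ (suc i)) ×
    SignTail (drop s γ))

-- Irreducible characters of S_n via the Murnaghan–Nakayama rule,
-- implemented on beta-sets (first-column hook lengths).
-- beta (λ_1,…,λ_ℓ) = { λ_i + ℓ - i }.  Removing a rim hook of size r
-- corresponds to replacing a bead b by b - r (b - r ≥ 0 and unoccupied);
-- its leg length is the number of beads strictly between b - r and b.

beta : List ℕ → List ℕ
beta []       = []
beta (x ∷ xs) = (x + length xs) ∷ beta xs

sgn : ℕ → ℤ
sgn zero    = + 1
sgn (suc n) = - sgn n

removals : ℕ → List ℕ → List (ℕ × List ℕ)
removals r B = go [] B
  where
  go : List ℕ → List ℕ → List (ℕ × List ℕ)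
  go pre []        = []
  go pre (b ∷ suf) =
    (if (r ≤ᵇ b) ∧ not (any (λ c → c ≡ᵇ (b ∸ r)) B)
     then [ (length (filter (λ c → (b ∸ r) Data.Nat.<? c) (filter (λ c → c Data.Nat.<? b) B))
            , pre ++ ((b ∸ r) ∷ suf)) ]
     else [])
    ++ go (pre ++ [ b ]) suf

sumℤ : List ℤ → ℤ
sumℤ = foldr ℤ._+_ (+ 0)

chiβ : List ℕ → List ℕ → ℤ
chiβ B []      = if all (λ b → b <ᵇ length B) B then + 1 else + 0
chiβ B (r ∷ μ) = sumℤ (map (λ p → sgn (proj₁ p) ℤ.* chiβ (proj₂ p) μ) (removals r B))

χ : List ℕ → List ℕ → ℤ
χ λ′ μ = chiβ (beta λ′) μ

{-# OPTIONS --safe #-}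
-- First, k ≥ 4: for k ≤ 3 the hypotheses give α₁ > α₂ + ⋯ + α_h, which puts α in Sign along with
-- (α₂, …, α_h). The character is then computed with the Murnaghan–Nakayama rule on beta-sets. Write
-- a = α₂, d = α₁ − α₂, P = α₃ + ⋯ + α_{k−1} and m = α₁ − x − 1, the number of parts 1 of β; the
-- beta-set of β is {α₁ + a + P, α₁, m, m − 1, …, 1}, and α₁ can be removed in exactly two ways.
-- Moving the bead α₁ to 0 leaves a one-row partition, with leg length m. Moving the top bead down
-- to a + P forces the rest: α₂ can only move the bead a to 0 (leg length a − 1), and then each of
-- α₃, …, α_{k−1} can only move the top bead further down, until a one-row partition is reached
-- again; every other bead is blocked because k is minimal, α_{k−1} > x and d ∉ α. The legs of the
-- sliding top bead telescope to the number of beads it passes: a + 1, …, a + d − x − 1, and α₁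
-- exactly once, on the first move or later. So both terms equal (−1)^m.
module Submission where

open import Defs
open import Data.Nat using (ℕ; suc; _+_; _∸_; _≤_; _<_; _>_)
open import Data.Integer using (+_; _*_)
open import Data.List using (List; _∷_; length)
open import Data.List.Membership.Propositional using (_∈_)
open import Data.Product using (_×_)
open import Relation.Nullary using (¬_)
open import Relation.Binary.PropositionalEquality using (_≡_)

open import Data.Bool using (Bool; true; false; if_then_else_; _∧_; not)
open import Data.Bool.ListAction using (any; all)
open import Data.Bool.Properties using (T-≡)
open import Data.Empty using (⊥-elim)
open import Data.Integer as ℤ using (ℤ)
import Data.Integer.Properties as ℤ
open import Data.List as List using ([]; _++_; [_]; filter; map; applyDownFrom; take; drop)
open import Data.List.Membership.Propositional using (_∉_)
open import Data.List.Membership.Propositional.Properties using (∈-++⁻; ∈-++⁺ˡ; ∈-++⁺ʳ; ∈-applyDownFrom⁻)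
open import Data.List.Properties
  using (++-assoc; ++-identityʳ; filter-++; filter-accept; filter-reject; filter-all;
         length-++; length-++-sucʳ; length-applyDownFrom; take++drop≡id)
open import Data.List.Relation.Unary.All as All using (All; []; _∷_)
open import Data.List.Relation.Unary.All.Properties
  using (++⁺; ++⁻ˡ; ++⁻ʳ; all⁻; All¬⇒¬Any; ¬Any⇒All¬; take⁺; drop⁺)
open import Data.List.Relation.Unary.Any as Any using (here; there)
open import Data.List.Relation.Unary.Any.Properties using (any⁺; any⁻)
open import Data.List.Relation.Unary.Linked using (Linked; [-]; _∷_)
open import Data.Nat using (zero; _≥_; _≤ᵇ_; _≡ᵇ_; _<ᵇ_; z≤n; s≤s; s≤s⁻¹; z<s)
open import Data.Nat.ListAction using (sum)
open import Data.Nat.ListAction.Properties using (sum-++)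
open import Data.Nat.Properties
open import Data.Nat.Tactic.RingSolver using (solve-∀)
open import Data.Product using (_,_; proj₁; proj₂)
open import Data.Sum using (_⊎_; inj₁; inj₂; [_,_]′)
open import Function using (_∘_; _∋_)
open import Function.Bundles using (Equivalence)
open import Relation.Binary.Definitions using (tri<; tri≈; tri>)
open import Relation.Binary.PropositionalEquality
  using (_≢_; refl; sym; trans; cong; cong₂; subst; ≢-sym; module ≡-Reasoning)
open import Relation.Nullary using (yes; no; contradiction)

sgn-+ : ∀ m n → sgn (m + n) ≡ sgn m * sgn n
sgn-+ zero    n = sym (ℤ.*-identityˡ (sgn n))
sgn-+ (suc m) n = trans (cong ℤ.-_ (sgn-+ m n)) (ℤ.neg-distribˡ-* (sgn m) (sgn n))

z+z≡2*z : ∀ z → z ℤ.+ z ≡ + 2 * z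
z+z≡2*z z = sym (trans (ℤ.*-distribʳ-+ z (+ 1) (+ 1)) (cong₂ ℤ._+_ (ℤ.*-identityˡ z) (ℤ.*-identityˡ z)))

m+[n+o]∸n≡m+o : ∀ m n o → m + (n + o) ∸ n ≡ m + o
m+[n+o]∸n≡m+o m n o = trans (+-∸-assoc m (m≤m+n n o)) (cong (_+_ m) (m+n∸m≡n n o))

All-insert : ∀ {P : ℕ → Set} pre {y : ℕ} suf → All P (pre ++ suf) → P y → All P (pre ++ y ∷ suf)
All-insert pre suf all py = ++⁺ (++⁻ˡ pre all) (py ∷ ++⁻ʳ pre all)

∈-insert : ∀ {t : ℕ} pre {y} suf → t ∈ pre ++ suf → t ∈ pre ++ y ∷ suf
∈-insert pre suf t∈ with ∈-++⁻ pre t∈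
... | inj₁ t∈pre = ∈-++⁺ˡ t∈pre
... | inj₂ t∈suf = ∈-++⁺ʳ pre (there t∈suf)

movable : ℕ → List ℕ → ℕ → Bool
movable r B b = (r ≤ᵇ b) ∧ not (any (_≡ᵇ b ∸ r) B)

Movable Immovable : ℕ → List ℕ → ℕ → Set
Movable   r B b = movable r B b ≡ true
Immovable r B b = movable r B b ≡ false

leg : ℕ → ℕ → List ℕ → ℕ
leg t b B = length (filter (t <?_) (filter (_<? b) B))

any-≡ᵇ-true : ∀ {t B} → t ∈ B → any (_≡ᵇ t) B ≡ true
any-≡ᵇ-true {t} t∈B = Equivalence.to T-≡ (any⁺ _ (Any.map (λ t≡y → ≡⇒≡ᵇ _ t (sym t≡y)) t∈B))

any-≡ᵇ-false : ∀ {t B} → t ∉ B → any (_≡ᵇ t) B ≡ false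
any-≡ᵇ-false {t} {B} t∉B with any (_≡ᵇ t) B in occurs
... | false = refl
... | true  = contradiction (Any.map (λ y≡ᵇt → sym (≡ᵇ⇒≡ _ t y≡ᵇt)) (any⁻ _ B (Equivalence.from T-≡ occurs))) t∉B

movable-true : ∀ {r B b} → r ≤ b → b ∸ r ∉ B → Movable r B b
movable-true {r} {B} {b} r≤b t∉B rewrite Equivalence.to T-≡ (≤⇒≤ᵇ r≤b) | any-≡ᵇ-false t∉B = refl

movable-false : ∀ {r B b} → (r ≤ b → b ∸ r ∈ B) → Immovable r B b
movable-false {r} {B} {b} blocked with r ≤ᵇ b in fits
... | false = refl
... | true rewrite any-≡ᵇ-true (blocked (≤ᵇ⇒≤ r b (Equivalence.from T-≡ fits))) = refl

movable-small : ∀ {r B b} → b < r → Immovable r B b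
movable-small {r} {B} {b} b<r = movable-false {r} {B} {b} (λ r≤b → contradiction r≤b (<⇒≱ b<r))

-- scan is a copy of the local function go of removals, which cannot be referred to by name.
removal : ℕ → List ℕ → List ℕ → ℕ → List ℕ → List (ℕ × List ℕ)
removal r B pre b suf = if movable r B b then [ (leg (b ∸ r) b B , pre ++ (b ∸ r) ∷ suf) ] else []

scan : ℕ → List ℕ → List ℕ → List ℕ → List (ℕ × List ℕ)
scan r B pre []        = []
scan r B pre (b ∷ suf) = removal r B pre b suf ++ scan r B (pre ++ [ b ]) suf

scan-unique : ∀ r B (go : List ℕ → List ℕ → List (ℕ × List ℕ)) →
  (∀ pre → go pre [] ≡ []) →
  (∀ pre b suf → go pre (b ∷ suf) ≡ removal r B pre b suf ++ go (pre ++ [ b ]) suf) →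
  ∀ pre suf → go pre suf ≡ scan r B pre suf
scan-unique r B go go-[] go-∷ pre []        = go-[] pre
scan-unique r B go go-[] go-∷ pre (b ∷ suf) =
  trans (go-∷ pre b suf) (cong (removal r B pre b suf ++_) (scan-unique r B go go-[] go-∷ (pre ++ [ b ]) suf))

-- The metavariable _ standing for go is solved by unification, which needs go's arguments to be
-- variables not in its context: hence the padding s ++ [], abstracted only after the metavariable
-- has been created. The annotations disambiguate _∷_ from the constructor of All.
removals≡scan : ∀ r B → removals r B ≡ scan r B [] B
removals≡scan r []      = refl
removals≡scan r (b ∷ s) =
  subst (λ t → removals r (b ∷ t) ≡ scan r (b ∷ t) [] (b ∷ t)) (++-identityʳ s) (padded r b s)
  where
  padded : ∀ r b s → removals r (b ∷ (s ++ [])) ≡ scan r (b ∷ (s ++ [])) [] (b ∷ (s ++ []))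
  padded r b s with List ℕ ∋ b ∷ (s ++ [])
  ... | B with scan-unique r B _ (λ _ → refl) (λ _ _ _ → refl)
  ... | go≡scan with List ℕ ∋ b ∷ [] | s ++ []
  ... | pre | suf = cong (_ ++_) (go≡scan pre suf)

scan-skip : ∀ {r B} pre s t → All (Immovable r B) s → scan r B pre (s ++ t) ≡ scan r B (pre ++ s) t
scan-skip {r} {B} pre []      t []        = cong (λ p → scan r B p t) (sym (++-identityʳ pre))
scan-skip {r} {B} pre (y ∷ s) t (ym ∷ sm) rewrite ym =
  trans (scan-skip (pre ++ [ y ]) s t sm) (cong (λ p → scan r B p t) (++-assoc pre [ y ] s))

scan-none : ∀ {r B} pre s → All (Immovable r B) s → scan r B pre s ≡ []
scan-none         pre []      []        = refl
scan-none {r} {B} pre (y ∷ s) (ym ∷ sm) rewrite ym = scan-none (pre ++ [ y ]) s sm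

scan-movable : ∀ {r B} pre c s → Movable r B c →
  scan r B pre (c ∷ s) ≡ (leg (c ∸ r) c B , pre ++ (c ∸ r) ∷ s) ∷ scan r B (pre ++ [ c ]) s
scan-movable pre c s cm rewrite cm = refl

scan-single : ∀ {r} s₁ c s₂ → let B = s₁ ++ c ∷ s₂ in
  All (Immovable r B) s₁ → Movable r B c → All (Immovable r B) s₂ →
  scan r B [] B ≡ [ (leg (c ∸ r) c B , s₁ ++ (c ∸ r) ∷ s₂) ]
scan-single {r} s₁ c s₂ s₁m cm s₂m =
  trans (scan-skip [] s₁ (c ∷ s₂) s₁m) (trans (scan-movable s₁ c s₂ cm) (cong (List._∷_ _) (scan-none {r} _ s₂ s₂m)))

scan-pair : ∀ {r} y₁ y₂ s → let B = y₁ ∷ y₂ ∷ s in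
  Movable r B y₁ → Movable r B y₂ → All (Immovable r B) s →
  scan r B [] B ≡ (leg (y₁ ∸ r) y₁ B , (y₁ ∸ r) ∷ y₂ ∷ s) ∷ [ (leg (y₂ ∸ r) y₂ B , y₁ ∷ (y₂ ∸ r) ∷ s) ]
scan-pair {r} y₁ y₂ s y₁m y₂m sm =
  trans (scan-movable [] y₁ (y₂ ∷ s) y₁m)
        (cong (List._∷_ _) (trans (scan-movable [ y₁ ] y₂ s y₂m) (cong (List._∷_ _) (scan-none {r} _ s sm))))

signedSum : List ℕ → List (ℕ × List ℕ) → ℤ
signedSum μ rs = sumℤ (map (λ (l , B′) → sgn l * chiβ B′ μ) rs)

chiβ-via-scan : ∀ r μ B → chiβ B (r ∷ μ) ≡ signedSum μ (scan r B [] B)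
chiβ-via-scan r μ B = cong (signedSum μ) (removals≡scan r B)

chiβ-single : ∀ {r μ} s₁ c s₂ → let B = s₁ ++ c ∷ s₂ in
  All (Immovable r B) s₁ → Movable r B c → All (Immovable r B) s₂ →
  chiβ B (r ∷ μ) ≡ sgn (leg (c ∸ r) c B) * chiβ (s₁ ++ (c ∸ r) ∷ s₂) μ
chiβ-single {r} {μ} s₁ c s₂ s₁m cm s₂m =
  trans (chiβ-via-scan r μ (s₁ ++ c ∷ s₂))
        (trans (cong (signedSum μ) (scan-single {r} s₁ c s₂ s₁m cm s₂m)) (ℤ.+-identityʳ _))

chiβ-pair : ∀ {r μ} y₁ y₂ s → let B = y₁ ∷ y₂ ∷ s in
  Movable r B y₁ → Movable r B y₂ → All (Immovable r B) s →
  chiβ B (r ∷ μ) ≡ sgn (leg (y₁ ∸ r) y₁ B) * chiβ ((y₁ ∸ r) ∷ y₂ ∷ s) μ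
                   ℤ.+ sgn (leg (y₂ ∸ r) y₂ B) * chiβ (y₁ ∷ (y₂ ∸ r) ∷ s) μ
chiβ-pair {r} {μ} y₁ y₂ s y₁m y₂m sm =
  trans (chiβ-via-scan r μ (y₁ ∷ y₂ ∷ s))
        (trans (cong (signedSum μ) (scan-pair {r} y₁ y₂ s y₁m y₂m sm)) (cong (ℤ._+_ first) (ℤ.+-identityʳ _)))
  where first = sgn (leg (y₁ ∸ r) y₁ (y₁ ∷ y₂ ∷ s)) * chiβ ((y₁ ∸ r) ∷ y₂ ∷ s) μ

leg-++ : ∀ t b xs ys → leg t b (xs ++ ys) ≡ leg t b xs + leg t b ys
leg-++ t b xs ys rewrite filter-++ (_<? b) xs ys =
  trans (cong length (filter-++ (t <?_) (filter (_<? b) xs) (filter (_<? b) ys)))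
        (length-++ (filter (t <?_) (filter (_<? b) xs)))

leg-inside : ∀ {t b y} ys → t < y → y < b → leg t b (y ∷ ys) ≡ suc (leg t b ys)
leg-inside {t} {b} {y} ys t<y y<b
  rewrite filter-accept (_<? b) {y} {ys} y<b | filter-accept (t <?_) {y} {filter (_<? b) ys} t<y = refl

leg-outside : ∀ {t b y} ys → y ≤ t ⊎ b ≤ y → leg t b (y ∷ ys) ≡ leg t b ys
leg-outside {t} {b} {y} ys (inj₂ b≤y) rewrite filter-reject (_<? b) {y} {ys} (≤⇒≯ b≤y) = refl
leg-outside {t} {b} {y} ys (inj₁ y≤t) with y <? b
... | no  y≮b rewrite filter-reject (_<? b) {y} {ys} y≮b = refl
... | yes y<b rewrite filter-accept (_<? b) {y} {ys} y<b
                    | filter-reject (t <?_) {y} {filter (_<? b) ys} (≤⇒≯ y≤t) = refl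

leg-none : ∀ {t b} ys → All (λ y → y ≤ t ⊎ b ≤ y) ys → leg t b ys ≡ 0
leg-none []       []           = refl
leg-none (y ∷ ys) (out ∷ outs) = trans (leg-outside ys out) (leg-none ys outs)

leg-all : ∀ {t b} ys → All (λ y → t < y × y < b) ys → leg t b ys ≡ length ys
leg-all []       []                  = refl
leg-all (y ∷ ys) ((t<y , y<b) ∷ ins) = trans (leg-inside ys t<y y<b) (cong suc (leg-all ys ins))

leg-empty : ∀ t ys → leg t t ys ≡ 0
leg-empty t ys = leg-none ys (All.tabulate (λ {y} _ → [ inj₂ , inj₁ ]′ (≤-total t y)))

leg-split : ∀ {t u b} ys → t ≤ u → u ≤ b → u ∉ ys → leg t b ys ≡ leg t u ys + leg u b ys
leg-split []       _   _   _  = refl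
leg-split {t} {u} {b} (y ∷ ys) t≤u u≤b u∉ with <-cmp y u | leg-split ys t≤u u≤b (u∉ ∘ there)
... | tri≈ _ y≡u _ | _  = contradiction (here (sym y≡u)) u∉
... | tri< y<u _ _ | IH rewrite leg-outside {u} {b} ys (inj₁ (<⇒≤ y<u)) with t <? y
...   | yes t<y rewrite leg-inside ys t<y (<-≤-trans y<u u≤b) | leg-inside ys t<y y<u = cong suc IH
...   | no  t≮y rewrite leg-outside {t} {b} ys (inj₁ (≮⇒≥ t≮y)) | leg-outside {t} {u} ys (inj₁ (≮⇒≥ t≮y)) = IH
leg-split {t} {u} {b} (y ∷ ys) t≤u u≤b u∉ | tri> _ _ u<y | IH
  rewrite leg-outside {t} {u} ys (inj₂ (<⇒≤ u<y)) with y <? b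
...   | yes y<b rewrite leg-inside ys (≤-<-trans t≤u u<y) y<b | leg-inside ys u<y y<b = trans (cong suc IH) (sym (+-suc _ _))
...   | no  y≮b rewrite leg-outside {t} {b} ys (inj₂ (≮⇒≥ y≮b)) | leg-outside {u} {b} ys (inj₂ (≮⇒≥ y≮b)) = IH

all-<ᵇ : ∀ {n} B → All (_< n) B → all (_<ᵇ n) B ≡ true
all-<ᵇ {n} B bounded = Equivalence.to T-≡ (all⁻ (_<ᵇ n) (All.map <⇒<ᵇ bounded))

-- pre ++ suf lists 0, …, K − 1, so pre ++ N ∷ suf is the beta-set of the one-row partition (N − K).
chiβ-row : ∀ {K} pre suf → All (_< K) (pre ++ suf) → (∀ {t} → t < K → t ∈ pre ++ suf) →
  length (pre ++ suf) ≡ K → ∀ {N} μ → All (1 ≤_) μ → N ≡ K + sum μ → chiβ (pre ++ N ∷ suf) μ ≡ + 1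
chiβ-row {K} pre suf bounded complete size {N} [] [] N≡K+0
  rewrite length-++-sucʳ pre N suf | size
        | all-<ᵇ (pre ++ N ∷ suf)
            (All-insert pre suf (All.map m<n⇒m<1+n bounded) (s≤s (≤-reflexive (trans N≡K+0 (+-identityʳ K))))) = refl
chiβ-row {K} pre suf bounded complete size {N} (r ∷ μ) (1≤r ∷ μ⁺) N≡ = begin
    chiβ (pre ++ N ∷ suf) (r ∷ μ)
  ≡⟨ chiβ-single {r} {μ} pre N suf (++⁻ˡ pre blocked) N-movable (++⁻ʳ pre blocked) ⟩
    sgn (leg (N ∸ r) N (pre ++ N ∷ suf)) * chiβ (pre ++ (N ∸ r) ∷ suf) μ
  ≡⟨ cong₂ (λ l χ′ → sgn l * χ′) no-leg (chiβ-row pre suf bounded complete size μ μ⁺ N∸r≡) ⟩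
    + 1
  ∎
  where
  open ≡-Reasoning
  N∸r≡ : N ∸ r ≡ K + sum μ
  N∸r≡ = trans (cong (_∸ r) N≡) (m+[n+o]∸n≡m+o K r (sum μ))
  K≤N∸r : K ≤ N ∸ r
  K≤N∸r = subst (K ≤_) (sym N∸r≡) (m≤m+n K (sum μ))
  r≤N : r ≤ N
  r≤N = subst (r ≤_) (sym N≡) (≤-trans (m≤m+n r (sum μ)) (m≤n+m (r + sum μ) K))
  blocked : All (Immovable r (pre ++ N ∷ suf)) (pre ++ suf)
  blocked = All.map (λ y<K → movable-false {r} {pre ++ N ∷ suf}
                               (λ _ → ∈-insert pre suf (complete (≤-<-trans (m∸n≤m _ r) y<K))))
                    bounded
  N-movable : Movable r (pre ++ N ∷ suf) N
  N-movable = movable-true r≤N (All¬⇒¬Any (All-insert pre suf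
    (All.map (λ y<K N∸r≡y → <⇒≢ (<-≤-trans y<K K≤N∸r) (sym N∸r≡y)) bounded)
    (λ N∸r≡N → <⇒≢ (∸-monoʳ-< 1≤r r≤N) N∸r≡N)))
  no-leg : leg (N ∸ r) N (pre ++ N ∷ suf) ≡ 0
  no-leg = leg-none (pre ++ N ∷ suf) (All-insert pre suf
    (All.map (λ y<K → inj₁ (≤-trans (<⇒≤ y<K) K≤N∸r)) bounded) (inj₂ ≤-refl))

span : ℕ → ℕ → List ℕ
span lo = applyDownFrom (λ i → lo + suc i)

length-span : ∀ lo n → length (span lo n) ≡ n
length-span lo = length-applyDownFrom _

∈-span⁺ : ∀ {lo t} n → lo < t → t ≤ lo + n → t ∈ span lo n
∈-span⁺ {lo}     zero    lo<t t≤lo = contradiction (subst (_ ≤_) (+-identityʳ lo) t≤lo) (<⇒≱ lo<t)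
∈-span⁺ {lo} {t} (suc n) lo<t t≤   with m≤n⇒m<n∨m≡n t≤
... | inj₁ t<   = there (∈-span⁺ n lo<t (s≤s⁻¹ (subst (t <_) (+-suc lo n) t<)))
... | inj₂ refl = here refl

∈-span⁻ : ∀ {lo t} n → t ∈ span lo n → lo < t × t ≤ lo + n
∈-span⁻ {lo} n t∈ with i , i<n , refl ← ∈-applyDownFrom⁻ _ t∈ = m<m+n lo z<s , +-monoʳ-≤ lo i<n

span⁻ : ∀ lo n → All (λ t → lo < t × t ≤ lo + n) (span lo n)
span⁻ lo n = All.tabulate (∈-span⁻ n)

span-++ : ∀ lo k n → span lo (n + k) ≡ span (lo + k) n ++ span lo k
span-++ lo k zero    = refl
span-++ lo k (suc n) = cong₂ _∷_ (shift lo k n) (span-++ lo k n)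
  where
  shift : ∀ lo k n → lo + suc (n + k) ≡ lo + k + suc n
  shift = solve-∀

length-ones : ∀ n → length (ones n) ≡ n
length-ones zero    = refl
length-ones (suc n) = cong suc (length-ones n)

beta-ones : ∀ n → beta (ones n) ≡ span 0 n
beta-ones zero    = refl
beta-ones (suc n) = cong₂ _∷_ (cong suc (length-ones n)) (beta-ones n)

ones-positive : ∀ n → All (1 ≤_) (ones n)
ones-positive zero    = []
ones-positive (suc n) = s≤s z≤n ∷ ones-positive n

ones-sorted : ∀ {y} n → 1 ≤ y → Linked _≥_ (y ∷ ones n)
ones-sorted zero    1≤y = [-]
ones-sorted (suc n) 1≤y = 1≤y ∷ ones-sorted n ≤-refl

shape : ℕ → ℕ → ℕ → List ℕ
shape n x M = n ∷ (x + 1) ∷ ones M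

shape-isPartition : ∀ {n x} M → x < n → IsPartition (shape n x M)
shape-isPartition {n} {x} M x<n =
  (≤-<-trans z≤n x<n ∷ 1≤x+1 ∷ ones-positive M) , (subst (_≤ n) (+-comm 1 x) x<n ∷ ones-sorted M 1≤x+1)
  where 1≤x+1 = m≤n+m 1 x

shape-hook : ∀ {n x} M → 0 < n → hook (shape n x M) 2 1 ≡ x + M + 1
shape-hook {n} {x} M 0<n = cong₂ (λ u v → u + v + 1) (m+n∸n≡m x 1)
  (trans (cong (λ l → length l ∸ 2) (filter-all (1 ≤?_) {shape n x M} (0<n ∷ m≤n+m 1 x ∷ ones-positive M)))
         (length-ones M))

β : List ℕ → ℕ → List ℕ
β α x = shape (size α ∸ at α 1) x (at α 1 ∸ x ∸ 1)

Theorem3Claims : List ℕ → ℕ → Set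
Theorem3Claims α x =
  IsPartition (β α x) × hook (β α x) 2 1 ≡ at α 1 × χ (β α x) α ≡ + 2 * sgn (at α 1 ∸ x ∸ 1)

-- Here a = α₂, d = α₁ − α₂ = e + x + 1 and x = |ρ| = α_k + ⋯ + α_h, so that m = α₁ − x − 1. The
-- beta-set of β is α₁ + (a + P) ∷ α₁ ∷ span 0 m, where P = α₃ + ⋯ + α_{k−1}. After α₂ has moved the
-- bead a to 0, the beads other than the top one are F: α₁ together with D = {0, …, m} ∖ {a}.
module Beads (b e : ℕ) (ρ : List ℕ) (ρ⁺ : All (1 ≤_) ρ) where

  x a d α₁ m : ℕ
  x  = sum ρ
  a  = suc b
  d  = suc (e + x)
  α₁ = a + d
  m  = a + e

  D F : List ℕ
  D = span a e ++ 0 ∷ span 0 b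
  F = α₁ ∷ D

  α₁≡ : α₁ ≡ suc (m + x)
  α₁≡ = cong suc (regroup b e x)
    where
    regroup : ∀ b e x → b + suc (e + x) ≡ suc (b + e + x)
    regroup = solve-∀

  m<α₁ : m < α₁
  m<α₁ = subst (m <_) (sym α₁≡) (s≤s (m≤m+n m x))

  x<a⇒d≤m : x < a → d ≤ m
  x<a⇒d≤m x<a = begin
      d          ≡⟨ sym (+-suc e x) ⟩
      e + suc x  ≤⟨ +-monoʳ-≤ e x<a ⟩
      e + a      ≡⟨ +-comm e a ⟩
      m          ∎
    where open ≤-Reasoning

  ∈-D⁺ : ∀ {t} → t ≤ m → t ≢ a → t ∈ D
  ∈-D⁺ {t} t≤m t≢a with <-cmp t a
  ... | tri≈ _ t≡a _ = contradiction t≡a t≢a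
  ... | tri> _ _ a<t = ∈-++⁺ˡ (∈-span⁺ e a<t t≤m)
  ... | tri< t<a _ _ with t
  ...   | zero  = ∈-++⁺ʳ (span a e) (here refl)
  ...   | suc t = ∈-++⁺ʳ (span a e) (there (∈-span⁺ b (s≤s z≤n) (s≤s⁻¹ t<a)))

  D⁻ : All (λ t → t ≤ m × t ≢ a) D
  D⁻ = ++⁺ (All.map (λ (a<t , t≤m) → t≤m , ≢-sym (<⇒≢ a<t)) (span⁻ a e))
           ((z≤n , λ ()) ∷ All.map (λ (_ , t≤b) → ≤-trans (m≤n⇒m≤1+n t≤b) (m≤m+n a e) , <⇒≢ (s≤s t≤b)) (span⁻ 0 b))

  length-D : length D ≡ m
  length-D = trans (length-++ (span a e)) (trans (cong₂ _+_ (length-span a e) (cong suc (length-span 0 b))) (+-comm e a))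

  span-m : span 0 m ≡ span a e ++ a ∷ span 0 b
  span-m = trans (cong (span 0) (+-comm a e)) (span-++ 0 a e)

  Clear Free : ℕ → Set
  Clear P = e < P × d ≢ P
  Free  P = P ≡ 0 ⊎ Clear P

  free⇒∉F : ∀ {P} → Free P → a + P ∉ F
  free⇒∉F free (here a+P≡α₁) with free
  ... | inj₁ refl      = contradiction (+-cancelˡ-≡ a 0 d a+P≡α₁) λ ()
  ... | inj₂ (_ , d≢P) = d≢P (sym (+-cancelˡ-≡ a _ d a+P≡α₁))
  free⇒∉F free (there a+P∈D) with All.lookup D⁻ a+P∈D | free
  ... | _ , a+P≢a | inj₁ refl      = a+P≢a (+-identityʳ a)
  ... | a+P≤m , _ | inj₂ (e<P , _) = <⇒≱ (+-monoʳ-< a e<P) a+P≤m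

  -- The conditions satisfied by α₃, …, α_{k−1}: α_{k−1} > x, the minimality of k, and d ∉ α.
  MiddlePart : ℕ → Set
  MiddlePart c = x < c × d ≤ c + x × d ≢ c

  middleParts : ∀ {ℓ} π → All (ℓ ≤_) π → x < ℓ → d ≤ ℓ + x → All (d ≢_) π → All MiddlePart π
  middleParts π ℓ≤ x<ℓ d≤ℓ+x d∉ =
    All.zipWith (λ (ℓ≤c , d≢c) → <-≤-trans x<ℓ ℓ≤c , ≤-trans d≤ℓ+x (+-monoˡ-≤ x ℓ≤c) , d≢c) (ℓ≤ , d∉)

  middle⇒e<c : ∀ {c} → MiddlePart c → e < c
  middle⇒e<c {c} (_ , d≤c+x , _) = +-cancelʳ-< x e c d≤c+x

  sum-clear : ∀ {c} π → All MiddlePart (c ∷ π) → Clear (sum (c ∷ π))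
  sum-clear {c} π (mc ∷ mπ) = <-≤-trans (middle⇒e<c mc) (m≤m+n c (sum π)) , d≢ π mπ
    where
    d≢ : ∀ π → All MiddlePart π → d ≢ c + sum π
    d≢ []       []        = λ d≡c+0 → proj₂ (proj₂ mc) (trans d≡c+0 (+-identityʳ c))
    d≢ (c′ ∷ π) (mc′ ∷ _) = <⇒≢ (begin-strict
        d                ≤⟨ proj₁ (proj₂ mc′) ⟩
        c′ + x           <⟨ +-monoʳ-< c′ (proj₁ mc) ⟩
        c′ + c           ≡⟨ +-comm c′ c ⟩
        c + c′           ≤⟨ +-monoʳ-≤ c (m≤m+n c′ (sum π)) ⟩
        c + sum (c′ ∷ π) ∎)
      where open ≤-Reasoning

  sum-free : ∀ π → All MiddlePart π → Free (sum π)
  sum-free []      []     = inj₁ refl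
  sum-free (c ∷ π) middle = inj₂ (sum-clear π middle)

  below-a : ∀ {y c} → y ≤ m → e < c → y ∸ c < a
  below-a {y} {c} y≤m e<c = s≤s (begin
      y ∸ c      ≤⟨ ∸-mono y≤m e<c ⟩
      m ∸ suc e  ≡⟨ m+n∸n≡m b e ⟩
      b          ∎)
    where open ≤-Reasoning

  F-immovable : ∀ {c top} → MiddlePart c → All (Immovable c (top ∷ F)) F
  F-immovable {c} {top} mc@(x<c , _ , d≢c) =
      movable-false {c} {top ∷ F} {α₁} (λ c≤α₁ → there (there (∈-D⁺ α₁∸c≤m (α₁∸c≢a c≤α₁))))
    ∷ All.map (λ {y} (y≤m , _) → movable-false {c} {top ∷ F} {y} (λ _ →
                 let y∸c<a = below-a y≤m (middle⇒e<c mc) in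
                 there (there (∈-D⁺ (≤-trans (<⇒≤ y∸c<a) (m≤m+n a e)) (<⇒≢ y∸c<a)))))
              D⁻
    where
    α₁∸c≤m : α₁ ∸ c ≤ m
    α₁∸c≤m = m≤n+o⇒m∸n≤o α₁ c (begin
        a + suc (e + x)  ≡⟨ cong (_+_ a) (sym (+-suc e x)) ⟩
        a + (e + suc x)  ≤⟨ +-monoʳ-≤ a (+-monoʳ-≤ e x<c) ⟩
        a + (e + c)      ≡⟨ regroup a e c ⟩
        c + m            ∎)
      where
      open ≤-Reasoning
      regroup : ∀ a e c → a + (e + c) ≡ c + (a + e)
      regroup = solve-∀
    α₁∸c≢a : c ≤ α₁ → α₁ ∸ c ≢ a
    α₁∸c≢a c≤α₁ α₁∸c≡a = d≢c (sym (+-cancelˡ-≡ a c d (trans (cong (_+ c) (sym α₁∸c≡a)) (m∸n+n≡m c≤α₁))))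

  -- Each part moves only the top bead; the legs telescope because the positions it stops at are free.
  slide : ∀ π → All MiddlePart π → chiβ ((a + sum π) ∷ F) (π ++ ρ) ≡ sgn (leg a (a + sum π) F)
  slide [] [] = subst (λ t → chiβ (t ∷ F) ρ ≡ sgn (leg a t F)) (sym (+-identityʳ a))
                  (trans row (cong sgn (sym (leg-empty a F))))
    where
    initial : ∀ {t} → t < suc m → t ∈ a ∷ D
    initial {t} t<1+m with t ≟ a
    ... | yes refl = here refl
    ... | no  t≢a  = there (∈-D⁺ (s≤s⁻¹ t<1+m) t≢a)
    row : chiβ (a ∷ F) ρ ≡ + 1
    row = chiβ-row [ a ] D (s≤s (m≤m+n a e) ∷ All.map (s≤s ∘ proj₁) D⁻) initial (cong suc length-D) ρ ρ⁺ α₁≡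
  slide (c ∷ π) (mc ∷ mπ) = begin
      chiβ (top ∷ F) (c ∷ π ++ ρ)
    ≡⟨ chiβ-single {c} {π ++ ρ} [] top F [] top-movable (F-immovable {c} {top} mc) ⟩
      sgn (leg (top ∸ c) top (top ∷ F)) * chiβ ((top ∸ c) ∷ F) (π ++ ρ)
    ≡⟨ cong (λ t → sgn (leg t top (top ∷ F)) * chiβ (t ∷ F) (π ++ ρ)) (m+[n+o]∸n≡m+o a c P) ⟩
      sgn (leg (a + P) top (top ∷ F)) * chiβ ((a + P) ∷ F) (π ++ ρ)
    ≡⟨ cong₂ (λ l χ′ → sgn l * χ′) (leg-outside {a + P} {top} F (inj₂ ≤-refl)) (slide π mπ) ⟩
      sgn (leg (a + P) top F) * sgn (leg a (a + P) F)
    ≡⟨ sym (sgn-+ (leg (a + P) top F) (leg a (a + P) F)) ⟩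
      sgn (leg (a + P) top F + leg a (a + P) F)
    ≡⟨ cong sgn (trans (+-comm (leg (a + P) top F) (leg a (a + P) F))
                       (sym (leg-split F (m≤m+n a P) (+-monoʳ-≤ a (m≤n+m P c)) (free⇒∉F (sum-free π mπ))))) ⟩
      sgn (leg a top F)
    ∎
    where
    open ≡-Reasoning
    P = sum π
    top = a + (c + P)
    top-movable : Movable c (top ∷ F) top
    top-movable = movable-true (≤-trans (m≤m+n c P) (m≤n+m (c + P) a))
      (subst (_∉ top ∷ F) (sym (m+[n+o]∸n≡m+o a c P))
        λ { (here a+P≡top)  → <⇒≢ (+-monoʳ-< a (m<n+m P (≤-<-trans z≤n (proj₁ mc)))) a+P≡top
          ; (there a+P∈F) → free⇒∉F (sum-free π mπ) a+P∈F })

  leg-α₂ : ∀ P → leg 0 a ((a + P) ∷ α₁ ∷ span a e ++ a ∷ span 0 b) ≡ b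
  leg-α₂ P = begin
      leg 0 a ((a + P) ∷ α₁ ∷ span a e ++ a ∷ span 0 b)
    ≡⟨ trans (leg-outside {0} {a} (α₁ ∷ span a e ++ a ∷ span 0 b) (inj₂ (m≤m+n a P)))
             (leg-outside {0} {a} (span a e ++ a ∷ span 0 b) (inj₂ (m≤m+n a d))) ⟩
      leg 0 a (span a e ++ a ∷ span 0 b)
    ≡⟨ leg-++ 0 a (span a e) (a ∷ span 0 b) ⟩
      leg 0 a (span a e) + leg 0 a (a ∷ span 0 b)
    ≡⟨ cong₂ _+_ (leg-none (span a e) (All.map (λ (a<t , _) → inj₂ (<⇒≤ a<t)) (span⁻ a e)))
                 (trans (leg-outside {0} {a} (span 0 b) (inj₂ ≤-refl))
                        (leg-all (span 0 b) (All.map (λ (0<t , t≤b) → 0<t , s≤s t≤b) (span⁻ 0 b)))) ⟩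
      length (span 0 b)
    ≡⟨ length-span 0 b ⟩
      b
    ∎
    where open ≡-Reasoning

  remove-α₂ : ∀ {P} μ → 0 < P → P + x < a →
    chiβ ((a + P) ∷ α₁ ∷ span 0 m) (a ∷ μ) ≡ sgn b * chiβ ((a + P) ∷ F) μ
  remove-α₂ {P} μ 0<P P+x<a = begin
      chiβ ((a + P) ∷ α₁ ∷ span 0 m) (a ∷ μ)
    ≡⟨ cong (λ s → chiβ ((a + P) ∷ α₁ ∷ s) (a ∷ μ)) span-m ⟩
      chiβ (upper ++ a ∷ span 0 b) (a ∷ μ)
    ≡⟨ chiβ-single {a} {μ} upper a (span 0 b) upper-immovable a-movable lower-immovable ⟩
      sgn (leg (a ∸ a) a B) * chiβ (upper ++ (a ∸ a) ∷ span 0 b) μ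
    ≡⟨ cong (λ t → sgn (leg t a B) * chiβ (upper ++ t ∷ span 0 b) μ) (n∸n≡0 a) ⟩
      sgn (leg 0 a B) * chiβ ((a + P) ∷ F) μ
    ≡⟨ cong (λ l → sgn l * chiβ ((a + P) ∷ F) μ) (leg-α₂ P) ⟩
      sgn b * chiβ ((a + P) ∷ F) μ
    ∎
    where
    open ≡-Reasoning
    upper = (a + P) ∷ α₁ ∷ span a e
    B = upper ++ a ∷ span 0 b
    occupied : ∀ {t} → 0 < t → t ≤ m → t ∈ B
    occupied {t} 0<t t≤m = subst (λ s → t ∈ (a + P) ∷ α₁ ∷ s) span-m (there (there (∈-span⁺ m 0<t t≤m)))
    blocked : ∀ y {t} → y ∸ a ≡ t → 0 < t → t ≤ m → Immovable a B y
    blocked y refl 0<t t≤m = movable-false {a} {B} {y} (λ _ → occupied 0<t t≤m)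
    upper-immovable : All (Immovable a B) upper
    upper-immovable =
        blocked (a + P) (m+n∸m≡n a P) 0<P (≤-trans (<⇒≤ (≤-<-trans (m≤m+n P x) P+x<a)) (m≤m+n a e))
      ∷ blocked α₁ (m+n∸m≡n a d) z<s (x<a⇒d≤m (≤-<-trans (m≤n+m x P) P+x<a))
      ∷ All.map (λ {t} (a<t , t≤m) → blocked t refl (m<n⇒0<n∸m a<t) (≤-trans (m≤n+o⇒m∸n≤o t a t≤m) (m≤n+m e a)))
                (span⁻ a e)
    lower-immovable : All (Immovable a B) (span 0 b)
    lower-immovable = All.map (λ {t} (_ , t≤b) → movable-small {a} {B} {t} (s≤s t≤b)) (span⁻ 0 b)
    positive : All (0 <_) B
    positive = z<s ∷ z<s ∷ ++⁺ (All.map (λ (a<t , _) → ≤-<-trans z≤n a<t) (span⁻ a e)) (z<s ∷ All.map proj₁ (span⁻ 0 b))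
    a-movable : Movable a B a
    a-movable = movable-true {a} {B} {a} ≤-refl
      (subst (_∉ B) (sym (n∸n≡0 a)) (All¬⇒¬Any (All.map (λ 0<t 0≡t → <⇒≢ 0<t 0≡t) positive)))

  α₁-passed-once : ∀ {P} → d ≢ P → leg a (a + P) [ α₁ ] + leg (a + P) (α₁ + (a + P)) [ α₁ ] ≡ 1
  α₁-passed-once {P} d≢P =
    trans (sym (leg-split [ α₁ ] (m≤m+n a P) (m≤n+m (a + P) α₁)
                  λ { (here a+P≡α₁) → d≢P (+-cancelˡ-≡ a d P (sym a+P≡α₁)) }))
          (leg-inside [] (m<m+n a z<s) (m<m+n α₁ z<s))

  leg-top : ∀ {P} → e < P → let N = α₁ + (a + P) in leg (a + P) N (N ∷ α₁ ∷ span 0 m) ≡ leg (a + P) N [ α₁ ]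
  leg-top {P} e<P = begin
      leg (a + P) N (N ∷ α₁ ∷ span 0 m)
    ≡⟨ leg-outside {a + P} {N} (α₁ ∷ span 0 m) (inj₂ ≤-refl) ⟩
      leg (a + P) N ([ α₁ ] ++ span 0 m)
    ≡⟨ leg-++ (a + P) N [ α₁ ] (span 0 m) ⟩
      leg (a + P) N [ α₁ ] + leg (a + P) N (span 0 m)
    ≡⟨ cong (_+_ (leg (a + P) N [ α₁ ]))
            (leg-none {a + P} {N} (span 0 m) (All.map (λ (_ , t≤m) → inj₁ (≤-trans t≤m (<⇒≤ (+-monoʳ-< a e<P)))) (span⁻ 0 m))) ⟩
      leg (a + P) N [ α₁ ] + 0
    ≡⟨ +-identityʳ _ ⟩
      leg (a + P) N [ α₁ ]
    ∎
    where
    open ≡-Reasoning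
    N = α₁ + (a + P)

  leg-F : ∀ {P} → e < P → leg a (a + P) F ≡ leg a (a + P) [ α₁ ] + e
  leg-F {P} e<P = begin
      leg a (a + P) ([ α₁ ] ++ span a e ++ 0 ∷ span 0 b)
    ≡⟨ leg-++ a (a + P) [ α₁ ] D ⟩
      leg a (a + P) [ α₁ ] + leg a (a + P) (span a e ++ 0 ∷ span 0 b)
    ≡⟨ cong (_+_ (leg a (a + P) [ α₁ ])) (leg-++ a (a + P) (span a e) (0 ∷ span 0 b)) ⟩
      leg a (a + P) [ α₁ ] + (leg a (a + P) (span a e) + leg a (a + P) (0 ∷ span 0 b))
    ≡⟨ cong (_+_ (leg a (a + P) [ α₁ ])) (cong₂ _+_
         (trans (leg-all (span a e) (All.map (λ (a<t , t≤m) → a<t , ≤-<-trans t≤m (+-monoʳ-< a e<P)) (span⁻ a e)))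
                (length-span a e))
         (leg-none {a} {a + P} (0 ∷ span 0 b) (inj₁ z≤n ∷ All.map (λ (_ , t≤b) → inj₁ (m≤n⇒m≤1+n t≤b)) (span⁻ 0 b)))) ⟩
      leg a (a + P) [ α₁ ] + (e + 0)
    ≡⟨ cong (_+_ (leg a (a + P) [ α₁ ])) (+-identityʳ e) ⟩
      leg a (a + P) [ α₁ ] + e
    ∎
    where open ≡-Reasoning

  branch-α₁↦0 : ∀ {P} μ → All (1 ≤_) μ → α₁ + (a + P) ≡ suc m + sum μ →
    sgn (leg 0 α₁ (α₁ + (a + P) ∷ α₁ ∷ span 0 m)) * chiβ (α₁ + (a + P) ∷ 0 ∷ span 0 m) μ ≡ sgn m
  branch-α₁↦0 {P} μ μ⁺ N≡ = trans (cong₂ (λ l χ′ → sgn l * χ′) legs row) (ℤ.*-identityʳ (sgn m))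
    where
    legs : leg 0 α₁ (α₁ + (a + P) ∷ α₁ ∷ span 0 m) ≡ m
    legs = trans (leg-outside {0} {α₁} (α₁ ∷ span 0 m) (inj₂ (m≤m+n α₁ (a + P))))
          (trans (leg-outside {0} {α₁} (span 0 m) (inj₂ ≤-refl))
          (trans (leg-all (span 0 m) (All.map (λ (0<t , t≤m) → 0<t , ≤-<-trans t≤m m<α₁) (span⁻ 0 m)))
                 (length-span 0 m)))
    initial : ∀ {t} → t < suc m → t ∈ 0 ∷ span 0 m
    initial {zero}  _     = here refl
    initial {suc t} t<1+m = there (∈-span⁺ m z<s (s≤s⁻¹ t<1+m))
    row : chiβ (α₁ + (a + P) ∷ 0 ∷ span 0 m) μ ≡ + 1
    row = chiβ-row [] (0 ∷ span 0 m) (z<s ∷ All.map (s≤s ∘ proj₂) (span⁻ 0 m)) initial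
            (cong suc (length-span 0 m)) μ μ⁺ N≡

  branch-top↦a+P : ∀ c π → All MiddlePart (c ∷ π) → sum (c ∷ π) + x < a →
    let P = sum (c ∷ π) ; N = α₁ + (a + P) in
    sgn (leg (a + P) N (N ∷ α₁ ∷ span 0 m)) * chiβ ((a + P) ∷ α₁ ∷ span 0 m) (a ∷ (c ∷ π) ++ ρ) ≡ sgn m
  branch-top↦a+P c π middle P+x<a = begin
      sgn l * chiβ ((a + P) ∷ α₁ ∷ span 0 m) (a ∷ (c ∷ π) ++ ρ)
    ≡⟨ cong (sgn l *_) (trans (remove-α₂ ((c ∷ π) ++ ρ) (≤-<-trans z≤n e<P) P+x<a)
                              (cong (sgn b *_) (slide (c ∷ π) middle))) ⟩
      sgn l * (sgn b * sgn (leg a (a + P) F))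
    ≡⟨ sym (trans (sgn-+ l _) (cong (sgn l *_) (sgn-+ b _))) ⟩
      sgn (l + (b + leg a (a + P) F))
    ≡⟨ cong₂ (λ u v → sgn (u + (b + v))) (leg-top e<P) (leg-F e<P) ⟩
      sgn (leg (a + P) N [ α₁ ] + (b + (leg a (a + P) [ α₁ ] + e)))
    ≡⟨ cong sgn (regroup (leg a (a + P) [ α₁ ]) (leg (a + P) N [ α₁ ]) b e) ⟩
      sgn ((leg a (a + P) [ α₁ ] + leg (a + P) N [ α₁ ]) + (b + e))
    ≡⟨ cong (λ n → sgn (n + (b + e))) (α₁-passed-once d≢P) ⟩
      sgn m
    ∎
    where
    open ≡-Reasoning
    P = sum (c ∷ π)
    N = α₁ + (a + P)
    l = leg (a + P) N (N ∷ α₁ ∷ span 0 m)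
    e<P = proj₁ (sum-clear π middle)
    d≢P = proj₂ (sum-clear π middle)
    regroup : ∀ l₀ l₁ b e → l₁ + (b + (l₀ + e)) ≡ (l₀ + l₁) + (b + e)
    regroup = solve-∀

  chiβ-betaβ : ∀ c π → All MiddlePart (c ∷ π) → sum (c ∷ π) + x < a →
    chiβ (α₁ + (a + sum (c ∷ π)) ∷ α₁ ∷ span 0 m) (α₁ ∷ a ∷ (c ∷ π) ++ ρ) ≡ + 2 * sgn m
  chiβ-betaβ c π middle P+x<a = begin
      chiβ (N ∷ α₁ ∷ span 0 m) (α₁ ∷ μ)
    ≡⟨ chiβ-pair {α₁} {μ} N α₁ (span 0 m) N-movable α₁-movable small-immovable ⟩
      sgn (leg (N ∸ α₁) N B₀) * chiβ ((N ∸ α₁) ∷ α₁ ∷ span 0 m) μ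
        ℤ.+ sgn (leg (α₁ ∸ α₁) α₁ B₀) * chiβ (N ∷ (α₁ ∸ α₁) ∷ span 0 m) μ
    ≡⟨ cong₂ (λ t u → sgn (leg t N B₀) * chiβ (t ∷ α₁ ∷ span 0 m) μ ℤ.+ sgn (leg u α₁ B₀) * chiβ (N ∷ u ∷ span 0 m) μ)
             (m+n∸m≡n α₁ (a + P)) (n∸n≡0 α₁) ⟩
      sgn (leg (a + P) N B₀) * chiβ ((a + P) ∷ α₁ ∷ span 0 m) μ
        ℤ.+ sgn (leg 0 α₁ B₀) * chiβ (N ∷ 0 ∷ span 0 m) μ
    ≡⟨ cong₂ ℤ._+_ (branch-top↦a+P c π middle P+x<a) (branch-α₁↦0 μ μ⁺ N≡) ⟩
      sgn m ℤ.+ sgn m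
    ≡⟨ z+z≡2*z (sgn m) ⟩
      + 2 * sgn m
    ∎
    where
    open ≡-Reasoning
    P = sum (c ∷ π)
    N = α₁ + (a + P)
    B₀ = N ∷ α₁ ∷ span 0 m
    μ = a ∷ (c ∷ π) ++ ρ
    μ⁺ : All (1 ≤_) μ
    μ⁺ = z<s ∷ ++⁺ (All.map (λ (x<c , _) → ≤-<-trans z≤n x<c) middle) ρ⁺
    N≡ : N ≡ suc m + sum μ
    N≡ = begin
        α₁ + (a + P)           ≡⟨ cong (_+ (a + P)) α₁≡ ⟩
        suc (m + x) + (a + P)  ≡⟨ regroup m x a P ⟩
        suc m + (a + (P + x))  ≡⟨ cong (λ s → suc m + (a + s)) (sym (sum-++ (c ∷ π) ρ)) ⟩
        suc m + sum μ          ∎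
      where
      regroup : ∀ m x a P → suc (m + x) + (a + P) ≡ suc m + (a + (P + x))
      regroup = solve-∀
    N-movable : Movable α₁ B₀ N
    N-movable = movable-true (m≤m+n α₁ (a + P)) (subst (_∉ B₀) (sym (m+n∸m≡n α₁ (a + P))) λ
      { (here a+P≡N)          → <⇒≢ (m<n+m (a + P) z<s) a+P≡N
      ; (there (here a+P≡α₁)) → proj₂ (sum-clear π middle) (sym (+-cancelˡ-≡ a P d a+P≡α₁))
      ; (there (there a+P∈))  → <⇒≱ (+-monoʳ-< a (proj₁ (sum-clear π middle))) (proj₂ (∈-span⁻ {0} m a+P∈)) })
    α₁-movable : Movable α₁ B₀ α₁
    α₁-movable = movable-true {α₁} {B₀} {α₁} ≤-refl (subst (_∉ B₀) (sym (n∸n≡0 α₁))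
      (All¬⇒¬Any (All.map (λ 0<t 0≡t → <⇒≢ 0<t 0≡t) (z<s ∷ z<s ∷ All.map proj₁ (span⁻ 0 m)))))
    small-immovable : All (Immovable α₁ B₀) (span 0 m)
    small-immovable = All.map (λ {t} (_ , t≤m) → movable-small {α₁} {B₀} {t} (≤-<-trans t≤m m<α₁)) (span⁻ 0 m)

  claims : ∀ c π → All MiddlePart (c ∷ π) → sum (c ∷ π) + x < a → Theorem3Claims (α₁ ∷ a ∷ (c ∷ π) ++ ρ) x
  claims c π middle P+x<a = shape-isPartition M x<n , trans (shape-hook M (≤-<-trans z≤n x<n)) hook≡ , χ≡
    where
    α = α₁ ∷ a ∷ (c ∷ π) ++ ρ
    P = sum (c ∷ π)
    M = α₁ ∸ x ∸ 1
    M≡m : M ≡ m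
    M≡m = cong (_∸ 1) (trans (cong (_∸ x) α₁≡) (m+n∸n≡m (suc m) x))
    n≡ : size α ∸ α₁ ≡ a + (P + x)
    n≡ = trans (m+n∸m≡n α₁ (a + sum ((c ∷ π) ++ ρ))) (cong (_+_ a) (sum-++ (c ∷ π) ρ))
    x<n : x < size α ∸ α₁
    x<n = subst (x <_) (sym n≡) (s≤s (≤-trans (m≤n+m x P) (m≤n+m (P + x) b)))
    hook≡ : x + M + 1 ≡ α₁
    hook≡ = trans (cong (λ k → x + k + 1) M≡m) (trans (regroup x m) (sym α₁≡))
      where
      regroup : ∀ x m → x + m + 1 ≡ suc (m + x)
      regroup = solve-∀
    beta-β : beta (β α x) ≡ α₁ + (a + P) ∷ α₁ ∷ span 0 m
    beta-β = cong₂ _∷_ (trans (cong₂ (λ n k → n + suc k) n≡ length≡) (trans (regroup₁ a P x m) (cong (_+ (a + P)) (sym α₁≡))))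
            (cong₂ _∷_ (trans (cong (_+_ (x + 1)) length≡) (trans (regroup₂ x m) (sym α₁≡)))
                       (trans (beta-ones M) (cong (span 0) M≡m)))
      where
      length≡ = trans (length-ones M) M≡m
      regroup₁ : ∀ a P x m → a + (P + x) + suc m ≡ suc (m + x) + (a + P)
      regroup₁ = solve-∀
      regroup₂ : ∀ x m → x + 1 + m ≡ suc (m + x)
      regroup₂ = solve-∀
    χ≡ : χ (β α x) α ≡ + 2 * sgn M
    χ≡ = trans (cong (λ B → chiβ B α) beta-β) (trans (chiβ-betaβ c π middle P+x<a) (cong (λ k → + 2 * sgn k) (sym M≡m)))

InSign-∷ : ∀ {α₁ α′} → IsPartition (α₁ ∷ α′) → sum α′ < α₁ → InSign α′ → InSign (α₁ ∷ α′)
InSign-∷ {α₁} {α′} isP α′<α₁ (_ , s , s≤ , dominant , tail) = isP , suc s , s≤s s≤ , dominant′ , tail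
  where
  dominant′ : ∀ i → 1 ≤ i → i ≤ suc s → at (α₁ ∷ α′) i > tailSum (α₁ ∷ α′) (suc i)
  dominant′ 1             _ _         = α′<α₁
  dominant′ (suc (suc i)) _ (s≤s i<s) = dominant (suc i) (s≤s z≤n) i<s

take-≥-at : ∀ {y} ys j → Linked _≥_ (y ∷ ys) → All (at (y ∷ ys) (suc j) ≤_) (take (suc j) (y ∷ ys))
take-≥-at ys        zero    _               = ≤-refl ∷ []
take-≥-at []        (suc j) _               = z≤n ∷ []
take-≥-at (y₂ ∷ ys) (suc j) (y₂≤y ∷ sorted) = let ≥-at = take-≥-at ys j sorted in ≤-trans (All.head ≥-at) y₂≤y ∷ ≥-at

sum-drop-at : ∀ xs j → sum (drop j xs) ≡ at xs (suc j) + sum (drop (suc j) xs)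
sum-drop-at []       zero    = refl
sum-drop-at []       (suc j) = refl
sum-drop-at (y ∷ xs) zero    = refl
sum-drop-at (y ∷ xs) (suc j) = sum-drop-at xs j

theorem3 : (α : List ℕ) → IsPartition α →
  (k : ℕ) → 1 ≤ k → k ≤ suc (length α) →
  tailSum α k < at α 1 ∸ at α 2 →
  ((j : ℕ) → 1 ≤ j → j < k → ¬ (tailSum α j < at α 1 ∸ at α 2)) →
  ¬ InSign α → InSign (Data.List.drop 1 α) →
  at α 1 > at α 2 → at α 2 > tailSum α 3 →
  k ≤ length α →
  ¬ ((at α 1 ∸ at α 2) ∈ α) →
  at α (k ∸ 1) > tailSum α k →
  let x = tailSum α k
      β = (size α ∸ at α 1) ∷ (x + 1) ∷ ones (at α 1 ∸ x ∸ 1)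
  in IsPartition β × hook β 2 1 ≡ at α 1 × χ β α ≡ + 2 * sgn (at α 1 ∸ x ∸ 1)
theorem3 []              _   _ _  _ _ _ _ _ () _ _ _ _
theorem3 (_ ∷ [])        _   _ _  _ _ _ _ _ _ () _ _ _
theorem3 (_ ∷ 0 ∷ _)     _   _ _  _ _ _ _ _ _ () _ _ _
theorem3 (_ ∷ suc _ ∷ _) _   0 () _ _ _ _ _ _ _ _ _ _
theorem3 (_ ∷ suc _ ∷ _) _   1 _  _ _ _ _ _ _ _ _ _ ()
theorem3 (α₁ ∷ suc b ∷ α′) isP 2 _ _ x<d _ α∉Sign α′∈Sign _ _ _ _ _ =
  ⊥-elim (α∉Sign (InSign-∷ isP (<-≤-trans x<d (m∸n≤m α₁ (suc b))) α′∈Sign))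
theorem3 (α₁ ∷ suc b ∷ α′) isP 3 _ _ x<d _ α∉Sign α′∈Sign α₁>α₂ _ _ _ _ =
  ⊥-elim (α∉Sign (InSign-∷ isP (subst (suc b + sum α′ <_) (m+[n∸m]≡n (<⇒≤ α₁>α₂)) (+-monoʳ-< (suc b) x<d)) α′∈Sign))
theorem3 (_ ∷ suc _ ∷ []) _ (suc (suc (suc (suc _)))) _ _ _ _ _ _ _ _ (s≤s (s≤s ())) _ _
theorem3 (α₁ ∷ suc b ∷ c ∷ α′) (_ ∷ _ ∷ positive , _ ∷ _ ∷ sorted) (suc (suc (suc (suc j)))) _ _
         x<d minimal _ _ α₁>α₂ α₂>rest _ d∉α ℓ>x =
  subst (λ α → Theorem3Claims α x) (sym α≡) (B.claims c (take j α′) middle P+x<a)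
  where
  π = take (suc j) (c ∷ α′)
  ρ = drop (suc j) (c ∷ α′)
  ℓ = at (c ∷ α′) (suc j)
  x = sum ρ
  e = (α₁ ∸ suc b) ∸ suc x
  module B = Beads b e ρ (drop⁺ (suc j) positive)
  d≡ : α₁ ∸ suc b ≡ B.d
  d≡ = trans (sym (m∸n+n≡m x<d)) (+-suc e x)
  α≡ : α₁ ∷ suc b ∷ c ∷ α′ ≡ B.α₁ ∷ suc b ∷ π ++ ρ
  α≡ = cong₂ (λ u v → u ∷ suc b ∷ v) (trans (sym (m+[n∸m]≡n (<⇒≤ α₁>α₂))) (cong (_+_ (suc b)) d≡))
             (sym (take++drop≡id (suc j) (c ∷ α′)))
  d≤ℓ+x : α₁ ∸ suc b ≤ ℓ + x
  d≤ℓ+x = subst (α₁ ∸ suc b ≤_) (sum-drop-at (c ∷ α′) j) (≮⇒≥ (minimal (suc (suc (suc j))) (s≤s z≤n) ≤-refl))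
  middle = B.middleParts π (take-≥-at α′ j sorted) ℓ>x (subst (_≤ ℓ + x) d≡ d≤ℓ+x)
             (All.map (λ d≢y → d≢y ∘ trans d≡) (take⁺ (suc j) (All.tail (All.tail (¬Any⇒All¬ _ d∉α)))))
  P+x<a : sum π + x < suc b
  P+x<a = subst (_< suc b) (trans (cong sum (sym (take++drop≡id (suc j) (c ∷ α′)))) (sum-++ π ρ)) α₂>rest
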